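{- Let $q$ be odd, let $k \leq d$ be fixed, and let $Q$ be a non-degenerate quadratic form on $\mathbb{F}_q^d$. The number of distinct ordered distance vectors $\big(Q(x_i - x_j)\big)_{0 \leq i < j \leq k}$ arising from degenerate $k$-simplices $[x_0,\dots,x_k]$ in $\mathbb{F}_q^d$ is $O\!\left(k\, q^{\frac{(k+1)k}{2} - 1}\right)$ as $q \to \infty$.
   Context: A $k$-simplex $[x_0,\dots,x_k]$ in $\mathbb{F}_q^d$ is degenerate if the vectors $x_1-x_0,\dots,x_k-x_0$ are linearly dependent. -}

module Defs where

open import Level using (0ℓ)
open import Data.Nat using (ℕ; zero; suc; _≤_; _<_; _∸_; _*_; _^_; _/_)
open import Data.Fin using (Fin; zero; suc)
import Data.Fin as Fin
open import Data.Product using (Σ-syntax; ∃; ∃-syntax; _×_; _,_)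
open import Relation.Binary.PropositionalEquality using (_≡_; _≢_)
open import Relation.Nullary using (¬_)
open import Algebra.Structures using (IsCommutativeRing)
open import Function.Bundles using (_↔_)
open import Data.List using (List; length)
open import Data.List.Relation.Unary.Any using (Any)

record FiniteField : Set₁ where
  infixl 7 _·_
  infixl 6 _⊕_
  field
    Carrier : Set
    _⊕_     : Carrier → Carrier → Carrier
    _·_     : Carrier → Carrier → Carrier
    ⊖_      : Carrier → Carrier
    𝟘 𝟙     : Carrier
    isCommutativeRing : IsCommutativeRing _≡_ _⊕_ _·_ ⊖_ 𝟘 𝟙
    𝟙≢𝟘     : 𝟙 ≢ 𝟘
    inverse : ∀ x → x ≢ 𝟘 → ∃[ y ] (x · y ≡ 𝟙)
    size    : ℕ
    enum    : Fin size ↔ Carrier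

module _ (F : FiniteField) where
  open FiniteField F

  _⊝_ : Carrier → Carrier → Carrier
  x ⊝ y = x ⊕ (⊖ y)

  ∑ : (n : ℕ) → (Fin n → Carrier) → Carrier
  ∑ zero    f = 𝟘
  ∑ (suc n) f = f zero ⊕ ∑ n (λ i → f (suc i))

  Vec : ℕ → Set
  Vec d = Fin d → Carrier

  _-ᵥ_ : ∀ {d} → Vec d → Vec d → Vec d
  (x -ᵥ y) i = x i ⊝ y i

  QuadForm : ℕ → Set
  QuadForm d = Fin d → Fin d → Carrier

  evalQ : ∀ {d} → QuadForm d → Vec d → Carrier
  evalQ {d} A x = ∑ d (λ i → ∑ d (λ j → A i j · x i · x j))

  polar : ∀ {d} → QuadForm d → Vec d → Vec d → Carrier
  polar A x y = (evalQ A (λ i → x i ⊕ y i) ⊝ evalQ A x) ⊝ evalQ A y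

  NonDegenerate : ∀ {d} → QuadForm d → Set
  NonDegenerate {d} A = ∀ (x : Vec d) → (∀ y → polar A x y ≡ 𝟘) → ∀ i → x i ≡ 𝟘

  Simplex : ℕ → ℕ → Set
  Simplex d k = Fin (suc k) → Vec d

  Degenerate : ∀ {d k} → Simplex d k → Set
  Degenerate {d} {k} x =
    Σ[ c ∈ (Fin k → Carrier) ]
      ((¬ (∀ i → c i ≡ 𝟘)) ×
       (∀ (m : Fin d) → ∑ k (λ i → c i · ((x (suc i) -ᵥ x zero) m)) ≡ 𝟘))

  -- A (candidate) ordered distance vector, indexed by pairs (i , j);
  -- only the entries with i < j are meaningful.
  DistVec : ℕ → Set
  DistVec k = Fin (suc k) → Fin (suc k) → Carrier

  IsDistVecOf : ∀ {d k} → QuadForm d → DistVec k → Simplex d k → Set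
  IsDistVecOf A v x = ∀ i j → i Fin.< j → v i j ≡ evalQ A (x i -ᵥ x j)

  -- "the number of distinct distance vectors of degenerate k-simplices is
  --  at most N": there is a list of at most N vectors containing the
  --  distance vector of every degenerate k-simplex.
  DegDistCountAtMost : (d k : ℕ) → QuadForm d → ℕ → Set
  DegDistCountAtMost d k A N =
    Σ[ L ∈ List (DistVec k) ] (length L ≤ N ×
      (∀ (x : Simplex d k) → Degenerate x → Any (λ v → IsDistVecOf A v x) L))

module Submission where

-- The distance vector of [x₀, …, x_k] is a function of the Gram matrix
-- G i j = B (x_{i+1} − x₀) (x_{j+1} − x₀) of the polar form B, since
-- Q (x_i − x_j) = Q v_i + Q v_j − B v_i v_j and B v v = 2 Q v with 2 invertible for odd q.
-- Degenerate simplices have singular Gram matrices, so it suffices to cover the singular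
-- symmetric k × k matrices by k q^(k(k+1)/2 − 1) candidates.  Write such a matrix with first
-- row (g , b) and inner block M, and let c be a null vector.  If c₀ = 0, M is itself singular
-- and g, b are arbitrary.  Otherwise rescale c to (1 , e): then e M = −b and g = −e·b, and
-- e·b does not depend on the solution e because M is symmetric, so (b , M) determines g.
-- By induction the two cases contribute (k − 1) q^(k(k+1)/2 − 1) and q^(k(k+1)/2 − 1) candidates.

open import Defs
open import Level using (0ℓ)
open import Algebra.Bundles using (CommutativeRing)
open import Data.Bool.Base using (Bool; true; false)
open import Data.Empty using (⊥-elim)
open import Data.Fin as Fin using (Fin; zero; suc)
open import Data.Fin.Permutation using (permutation)
open import Data.Fin.Properties using (all?; toℕ-injective)
open import Data.List using (List; []; _∷_; [_]; _++_; map; concatMap; cartesianProductWith; cartesianProduct; length; allFin)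
open import Data.List.Membership.Propositional using (_∈_)
open import Data.List.Membership.Propositional.Properties using (∈-map⁺; ∈-allFin)
open import Data.List.Properties using (length-++; length-map; length-tabulate)
open import Data.List.Relation.Unary.Any as Any using (Any; here; any?; satisfied)
open import Data.List.Relation.Unary.Any.Properties using (++⁺ˡ; ++⁺ʳ; map⁺; concatMap⁺; cartesianProductWith⁺)
open import Data.Maybe using (nothing)
open import Data.Nat using (ℕ; zero; suc; _+_; _*_; _^_; _∸_; _/_; _≤_; z≤n; _<ᵇ_)
open import Data.Nat.Divisibility using (_∣_; divides)
open import Data.Nat.DivMod using (m*n/n≡m)
open import Data.Nat.Tactic.RingSolver using (solve-∀)
import Data.Nat.Properties as ℕ
open import Data.Product using (∃-syntax; _×_; _,_; proj₁; proj₂)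
open import Data.Vec.Functional using (Vector; tail)
import Data.Vec.Functional as V
open import Function using (_∘_; id; _↔_; Inverse)
open import Function.Properties.Inverse using (↔-sym; ↔⇒↣)
open import Relation.Binary.Definitions using (DecidableEquality)
open import Relation.Binary.PropositionalEquality hiding ([_])
open import Relation.Nullary using (¬_; Dec; yes; no)
open import Relation.Nullary.Decidable using (via-injection)

module _ {A B C : Set} (f : A → B → C) where

  length-cartesianProductWith : ∀ xs ys →
    length (cartesianProductWith f xs ys) ≡ length xs * length ys
  length-cartesianProductWith []       ys = refl
  length-cartesianProductWith (x ∷ xs) ys =
    trans (length-++ (map (f x) ys))
          (cong₂ _+_ (length-map (f x) ys) (length-cartesianProductWith xs ys))

length-concatMap-≤ : ∀ {A B : Set} (f : A → List B) {m} → (∀ x → length (f x) ≤ m) →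
  ∀ xs → length (concatMap f xs) ≤ length xs * m
length-concatMap-≤ f f≤m []       = z≤n
length-concatMap-≤ f f≤m (x ∷ xs) =
  ℕ.≤-trans (ℕ.≤-reflexive (length-++ (f x))) (ℕ.+-mono-≤ (f≤m x) (length-concatMap-≤ f f≤m xs))

module _ where
  open import Algebra.Properties.CommutativeMonoid.Sum ℕ.+-0-commutativeMonoid
    using (sum; sum-cong-≗; ∑-distrib-+; sum-permute)

  private
    indicator : Bool → ℕ
    indicator true  = 1
    indicator false = 0

    exactly-one-<ᵇ : ∀ m n → m ≢ n → indicator (m <ᵇ n) + indicator (n <ᵇ m) ≡ 1
    exactly-one-<ᵇ zero    zero    m≢n = ⊥-elim (m≢n refl)
    exactly-one-<ᵇ zero    (suc n) m≢n = refl
    exactly-one-<ᵇ (suc m) zero    m≢n = refl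
    exactly-one-<ᵇ (suc m) (suc n) m≢n = exactly-one-<ᵇ m n (m≢n ∘ cong suc)

    sum-ones : ∀ n → sum {n} (λ _ → 1) ≡ n
    sum-ones zero    = refl
    sum-ones (suc n) = cong suc (sum-ones n)

  -- Each orbit {i , φ i} contributes exactly one index with i < φ i.
  fixedPointFree-involution⇒even : ∀ {n} (φ : Fin n → Fin n) →
    (∀ i → φ (φ i) ≡ i) → (∀ i → φ i ≢ i) → 2 ∣ n
  fixedPointFree-involution⇒even {n} φ φφ≡id φi≢i = divides (sum ascends) (begin
    n                                        ≡⟨ sum-ones n ⟨
    sum {n} (λ _ → 1)                        ≡⟨ sum-cong-≗ orbit-count ⟨
    sum (λ i → ascends i + ascends (φ i))    ≡⟨ ∑-distrib-+ ascends (ascends ∘ φ) ⟩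
    sum ascends + sum (ascends ∘ φ)          ≡⟨ cong (sum ascends +_) (sum-permute ascends (permutation φ φ φφ≡id φφ≡id)) ⟨
    sum ascends + sum ascends                ≡⟨ cong (sum ascends +_) (ℕ.+-identityʳ _) ⟨
    2 * sum ascends                          ≡⟨ ℕ.*-comm 2 (sum ascends) ⟩
    sum ascends * 2                          ∎)
    where
    open ≡-Reasoning
    ascends : Fin n → ℕ
    ascends i = indicator (Fin.toℕ i <ᵇ Fin.toℕ (φ i))
    orbit-count : ∀ i → ascends i + ascends (φ i) ≡ 1
    orbit-count i rewrite φφ≡id i =
      exactly-one-<ᵇ (Fin.toℕ i) (Fin.toℕ (φ i)) (φi≢i i ∘ sym ∘ toℕ-injective)

triangle : ℕ → ℕ
triangle zero    = 0
triangle (suc k) = suc (k + triangle k)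

triangle≡k*[1+k]/2 : ∀ k → triangle k ≡ k * suc k / 2
triangle≡k*[1+k]/2 k = trans (sym (m*n/n≡m (triangle k) 2)) (cong (_/ 2) (twice k))
  where
  twice : ∀ k → triangle k * 2 ≡ k * suc k
  twice zero    = refl
  twice (suc k) = trans (expand k (triangle k)) (trans (cong (λ t → 2 + k * 2 + t) (twice k)) (regroup k))
    where
    expand : ∀ k t → suc (k + t) * 2 ≡ 2 + k * 2 + t * 2
    expand = solve-∀
    regroup : ∀ k → 2 + k * 2 + k * suc k ≡ suc k * suc (suc k)
    regroup = solve-∀

module Enumeration {A : Set} {q : ℕ} (enum : Fin q ↔ A) where
  open Inverse enum using (to; from; strictlyInverseˡ)

  _≟_ : DecidableEquality A
  _≟_ = via-injection (↔⇒↣ (↔-sym enum)) Fin._≟_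

  elements : List A
  elements = map to (allFin q)

  length-elements : length elements ≡ q
  length-elements = trans (length-map to (allFin q)) (length-tabulate id)

  ∈-elements : ∀ a → a ∈ elements
  ∈-elements a = subst (_∈ elements) (strictlyInverseˡ a) (∈-map⁺ to (∈-allFin (from a)))

  vectors : ∀ k → List (Vector A k)
  vectors zero    = [ (λ ()) ]
  vectors (suc k) = cartesianProductWith V._∷_ elements (vectors k)

  length-vectors : ∀ k → length (vectors k) ≡ q ^ k
  length-vectors zero    = refl
  length-vectors (suc k) = trans (length-cartesianProductWith V._∷_ elements (vectors k))
                                 (cong₂ _*_ length-elements (length-vectors k))

  vectors-complete : ∀ k (v : Vector A k) → Any (_≗ v) (vectors k)
  vectors-complete zero    v = here (λ ())
  vectors-complete (suc k) v =
    cartesianProductWith⁺ V._∷_ cons-≗ (∈-elements (v zero)) (vectors-complete k (tail v))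
    where
    cons-≗ : ∀ {a w} → v zero ≡ a → w ≗ tail v → (a V.∷ w) ≗ v
    cons-≗ v₀≡a w≗ zero    = sym v₀≡a
    cons-≗ v₀≡a w≗ (suc i) = w≗ i

module _ (F : FiniteField) where
  open FiniteField F
  open Enumeration enum

  commutativeRing : CommutativeRing 0ℓ 0ℓ
  commutativeRing = record { isCommutativeRing = isCommutativeRing }

  open CommutativeRing commutativeRing
    using ( +-assoc; +-identityˡ; +-identityʳ; -‿inverseʳ; *-assoc; *-comm; *-identityˡ
          ; zeroˡ; zeroʳ; distribˡ; +-group; semiring; commutativeSemiring )
  open import Algebra.Properties.Group +-group
    using (inverseˡ-unique; ∙-cancelˡ; ∙-cancelʳ; //-rightDividesˡ; //-rightDividesʳ)
  open import Algebra.Properties.Semiring.Sum semiring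
    using (sum; ∑-distrib-+; *-distribˡ-sum; sum-replicate-zero)
  open import Algebra.Solver.Ring.NaturalCoefficients commutativeSemiring (λ _ _ → nothing)
    using (solve; _:=_; _:+_; _:*_)

  ∑≡sum : ∀ n (f : Vector Carrier n) → ∑ F n f ≡ sum f
  ∑≡sum zero    f = refl
  ∑≡sum (suc n) f = cong (f zero ⊕_) (∑≡sum n (tail f))

  ∑-cong : ∀ n {f g : Vector Carrier n} → f ≗ g → ∑ F n f ≡ ∑ F n g
  ∑-cong zero    f≗g = refl
  ∑-cong (suc n) f≗g = cong₂ _⊕_ (f≗g zero) (∑-cong n (f≗g ∘ suc))

  ∑-distrib-⊕ : ∀ n (f g : Vector Carrier n) → ∑ F n (λ i → f i ⊕ g i) ≡ ∑ F n f ⊕ ∑ F n g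
  ∑-distrib-⊕ n f g rewrite ∑≡sum n (λ i → f i ⊕ g i) | ∑≡sum n f | ∑≡sum n g = ∑-distrib-+ f g

  *-distribˡ-∑ : ∀ n a (f : Vector Carrier n) → a · ∑ F n f ≡ ∑ F n (λ i → a · f i)
  *-distribˡ-∑ n a f rewrite ∑≡sum n f | ∑≡sum n (λ i → a · f i) = *-distribˡ-sum a f

  ∑-zero : ∀ n {f : Vector Carrier n} → (∀ i → f i ≡ 𝟘) → ∑ F n f ≡ 𝟘
  ∑-zero n f≗0 = trans (∑-cong n f≗0) (trans (∑≡sum n _) (sum-replicate-zero n))

  ∑-comm : ∀ m n (f : Fin m → Fin n → Carrier) →
    ∑ F m (λ i → ∑ F n (f i)) ≡ ∑ F n (λ j → ∑ F m (λ i → f i j))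
  ∑-comm zero    n f = sym (∑-zero n (λ _ → refl))
  ∑-comm (suc m) n f = trans (cong (∑ F n (f zero) ⊕_) (∑-comm m n (f ∘ suc)))
                             (sym (∑-distrib-⊕ n (f zero) _))

  -- If 𝟙 ⊕ 𝟙 ≡ 𝟘, translation by 𝟙 is a fixed-point-free involution of the field.
  𝟙⊕𝟙≢𝟘 : ¬ (2 ∣ size) → 𝟙 ⊕ 𝟙 ≢ 𝟘
  𝟙⊕𝟙≢𝟘 odd 𝟙⊕𝟙≡𝟘 = odd (fixedPointFree-involution⇒even φ φ-involutive φ-fixedPointFree)
    where
    open Inverse enum using (to; from; strictlyInverseˡ; strictlyInverseʳ)
    φ : Fin size → Fin size
    φ i = from (to i ⊕ 𝟙)
    shift-twice : ∀ a → (a ⊕ 𝟙) ⊕ 𝟙 ≡ a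
    shift-twice a = trans (+-assoc a 𝟙 𝟙) (trans (cong (a ⊕_) 𝟙⊕𝟙≡𝟘) (+-identityʳ a))
    φ-involutive : ∀ i → φ (φ i) ≡ i
    φ-involutive i = begin
      from (to (from (to i ⊕ 𝟙)) ⊕ 𝟙) ≡⟨ cong (λ a → from (a ⊕ 𝟙)) (strictlyInverseˡ _) ⟩
      from ((to i ⊕ 𝟙) ⊕ 𝟙)           ≡⟨ cong from (shift-twice (to i)) ⟩
      from (to i)                     ≡⟨ strictlyInverseʳ i ⟩
      i                               ∎
      where open ≡-Reasoning
    φ-fixedPointFree : ∀ i → φ i ≢ i
    φ-fixedPointFree i φi≡i = 𝟙≢𝟘 (∙-cancelˡ (to i) 𝟙 𝟘 (begin
      to i ⊕ 𝟙      ≡⟨ strictlyInverseˡ _ ⟨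
      to (φ i)      ≡⟨ cong to φi≡i ⟩
      to i          ≡⟨ +-identityʳ (to i) ⟨
      to i ⊕ 𝟘      ∎))
      where open ≡-Reasoning

  Matrix : ℕ → Set
  Matrix k = Fin k → Fin k → Carrier

  _≐_ : ∀ {k} → Matrix k → Matrix k → Set
  M ≐ N = ∀ i j → M i j ≡ N i j

  Symmetric : ∀ {k} → Matrix k → Set
  Symmetric M = ∀ i j → M i j ≡ M j i

  border : ∀ {k} → Carrier → Vector Carrier k → Matrix k → Matrix (suc k)
  border g b M zero    zero    = g
  border g b M zero    (suc j) = b j
  border g b M (suc i) zero    = b i
  border g b M (suc i) (suc j) = M i j

  corner : ∀ {k} → Matrix (suc k) → Carrier
  corner G = G zero zero

  edge : ∀ {k} → Matrix (suc k) → Vector Carrier k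
  edge G j = G zero (suc j)

  inner : ∀ {k} → Matrix (suc k) → Matrix k
  inner G i j = G (suc i) (suc j)

  inner-symmetric : ∀ {k} {G : Matrix (suc k)} → Symmetric G → Symmetric (inner G)
  inner-symmetric G-sym i j = G-sym (suc i) (suc j)

  border-≐ : ∀ {k} {G : Matrix (suc k)} {g b M} → Symmetric G →
    corner G ≡ g → b ≗ edge G → M ≐ inner G → border g b M ≐ G
  border-≐ G-sym g≡ b≗ M≐ zero    zero    = sym g≡
  border-≐ G-sym g≡ b≗ M≐ zero    (suc j) = b≗ j
  border-≐ G-sym g≡ b≗ M≐ (suc i) zero    = trans (b≗ i) (G-sym zero (suc i))
  border-≐ G-sym g≡ b≗ M≐ (suc i) (suc j) = M≐ i j

  _∙_ : ∀ {k} → Vector Carrier k → Vector Carrier k → Carrier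
  _∙_ {k} u v = ∑ F k (λ i → u i · v i)

  InKernel : ∀ {k} → Matrix k → Vector Carrier k → Set
  InKernel {k} G c = ∀ j → ∑ F k (λ i → c i · G i j) ≡ 𝟘

  -- e M = ⊖ b, i.e. the row (𝟙 , e) annihilates the block with top row b above M.
  Balances : ∀ {k} → Vector Carrier k → Matrix k → Vector Carrier k → Set
  Balances {k} b M e = ∀ j → b j ⊕ ∑ F k (λ i → e i · M i j) ≡ 𝟘

  balances? : ∀ {k} (b : Vector Carrier k) (M : Matrix k) e → Dec (Balances b M e)
  balances? {k} b M e = all? (λ j → (b j ⊕ ∑ F k (λ i → e i · M i j)) ≟ 𝟘)

  Balances-resp : ∀ {k} {b b' : Vector Carrier k} {M M' e e'} →
    b ≗ b' → M ≐ M' → e ≗ e' → Balances b M e → Balances b' M' e'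
  Balances-resp {k} b≗ M≐ e≗ bal j =
    trans (sym (cong₂ _⊕_ (b≗ j) (∑-cong k (λ i → cong₂ _·_ (e≗ i) (M≐ i j))))) (bal j)

  InKernel-scale : ∀ {k} {G : Matrix k} {c} a → InKernel G c → InKernel G (λ i → a · c i)
  InKernel-scale {k} {G} {c} a ker j = begin
    ∑ F k (λ i → (a · c i) · G i j)  ≡⟨ ∑-cong k (λ i → *-assoc a (c i) (G i j)) ⟩
    ∑ F k (λ i → a · (c i · G i j))  ≡⟨ *-distribˡ-∑ k a _ ⟨
    a · ∑ F k (λ i → c i · G i j)    ≡⟨ cong (a ·_) (ker j) ⟩
    a · 𝟘                            ≡⟨ zeroʳ a ⟩
    𝟘                                ∎
    where open ≡-Reasoning

  InKernel-inner : ∀ {k} {G : Matrix (suc k)} {c} → c zero ≡ 𝟘 → InKernel G c → InKernel (inner G) (tail c)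
  InKernel-inner {k} {G} {c} c₀≡𝟘 ker j = begin
    rest                            ≡⟨ +-identityˡ rest ⟨
    𝟘 ⊕ rest                        ≡⟨ cong (_⊕ rest) (trans (cong (_· G zero (suc j)) c₀≡𝟘) (zeroˡ _)) ⟨
    c zero · G zero (suc j) ⊕ rest  ≡⟨ ker (suc j) ⟩
    𝟘                               ∎
    where
    open ≡-Reasoning
    rest = ∑ F k (λ i → c (suc i) · G (suc i) (suc j))

  InKernel-unitPivot : ∀ {k} {G : Matrix (suc k)} {c} → Symmetric G → c zero ≢ 𝟘 → InKernel G c →
    ∃[ e ] (Balances (edge G) (inner G) e × corner G ⊕ e ∙ edge G ≡ 𝟘)
  InKernel-unitPivot {k} {G} {c} G-sym c₀≢𝟘 ker =
    e , (λ j → drop-pivot (scaled (suc j))) ,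
    trans (cong (corner G ⊕_) (∑-cong k (λ i → cong (e i ·_) (G-sym zero (suc i))))) (drop-pivot (scaled zero))
    where
    ι = proj₁ (inverse (c zero) c₀≢𝟘)
    ιc₀≡𝟙 : ι · c zero ≡ 𝟙
    ιc₀≡𝟙 = trans (*-comm ι (c zero)) (proj₂ (inverse (c zero) c₀≢𝟘))
    e : Vector Carrier k
    e i = ι · c (suc i)
    scaled : InKernel G (λ i → ι · c i)
    scaled = InKernel-scale {G = G} {c} ι ker
    drop-pivot : ∀ {a s} → (ι · c zero) · a ⊕ s ≡ 𝟘 → a ⊕ s ≡ 𝟘
    drop-pivot {a} {s} = subst (λ t → t ⊕ s ≡ 𝟘) (trans (cong (_· a) ιc₀≡𝟙) (*-identityˡ a))

  -- e ∙ b = ⊖ (e' M eᵀ) and e' ∙ b = ⊖ (e M e'ᵀ), which agree since M is symmetric.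
  Balances-dot-unique : ∀ {k} {b : Vector Carrier k} {M e e'} → Symmetric M →
    Balances b M e → Balances b M e' → e ∙ b ≡ e' ∙ b
  Balances-dot-unique {k} {b} {M} {e} {e'} M-sym bal bal' =
    ∙-cancelʳ (pairing e e') (e ∙ b) (e' ∙ b) (begin
      e ∙ b ⊕ pairing e e'   ≡⟨ pairing-balanced bal' ⟩
      𝟘                      ≡⟨ pairing-balanced bal ⟨
      e' ∙ b ⊕ pairing e' e  ≡⟨ cong (e' ∙ b ⊕_) (pairing-sym e' e) ⟩
      e' ∙ b ⊕ pairing e e'  ∎)
    where
    open ≡-Reasoning
    pairing : Vector Carrier k → Vector Carrier k → Carrier
    pairing u v = ∑ F k (λ j → u j · ∑ F k (λ i → v i · M i j))
    pairing-sym : ∀ u v → pairing u v ≡ pairing v u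
    pairing-sym u v = begin
      ∑ F k (λ j → u j · ∑ F k (λ i → v i · M i j))    ≡⟨ ∑-cong k (λ j → *-distribˡ-∑ k (u j) _) ⟩
      ∑ F k (λ j → ∑ F k (λ i → u j · (v i · M i j)))  ≡⟨ ∑-comm k k _ ⟩
      ∑ F k (λ i → ∑ F k (λ j → u j · (v i · M i j)))  ≡⟨ ∑-cong k (λ i → ∑-cong k (λ j →
                                                             trans (cong (λ t → u j · (v i · t)) (M-sym i j)) (swap (u j) (v i) _))) ⟩
      ∑ F k (λ i → ∑ F k (λ j → v i · (u j · M j i)))  ≡⟨ ∑-cong k (λ i → *-distribˡ-∑ k (v i) _) ⟨
      ∑ F k (λ i → v i · ∑ F k (λ j → u j · M j i))    ∎
      where
      swap : ∀ x y z → x · (y · z) ≡ y · (x · z)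
      swap = solve 3 (λ x y z → x :* (y :* z) := y :* (x :* z)) refl
    pairing-balanced : ∀ {u v} → Balances b M v → u ∙ b ⊕ pairing u v ≡ 𝟘
    pairing-balanced {u} {v} bal-v = begin
      u ∙ b ⊕ pairing u v                                   ≡⟨ ∑-distrib-⊕ k _ _ ⟨
      ∑ F k (λ j → u j · b j ⊕ u j · ∑ F k (λ i → v i · M i j)) ≡⟨ ∑-cong k (λ j → distribˡ (u j) _ _) ⟨
      ∑ F k (λ j → u j · (b j ⊕ ∑ F k (λ i → v i · M i j)))    ≡⟨ ∑-zero k (λ j → trans (cong (u j ·_) (bal-v j)) (zeroʳ (u j))) ⟩
      𝟘                                                     ∎

  bordered : ∀ {k} → (Vector Carrier k → Matrix k → List Carrier) →
    List (Vector Carrier k) → List (Matrix k) → List (Matrix (suc k))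
  bordered corners bs Ms =
    concatMap (λ (b , M) → map (λ g → border g b M) (corners b M)) (cartesianProduct bs Ms)

  length-bordered : ∀ {k} {corners : Vector Carrier k → Matrix k → List Carrier} {m} →
    (∀ b M → length (corners b M) ≤ m) →
    ∀ bs Ms → length (bordered corners bs Ms) ≤ length bs * length Ms * m
  length-bordered {corners = corners} {m} corners≤m bs Ms = ℕ.≤-trans
    (length-concatMap-≤ _ (λ (b , M) → ℕ.≤-trans (ℕ.≤-reflexive (length-map _ (corners b M))) (corners≤m b M))
                       (cartesianProduct bs Ms))
    (ℕ.≤-reflexive (cong (_* m) (length-cartesianProductWith _,_ bs Ms)))

  bordered-complete : ∀ {k} {G : Matrix (suc k)} {corners bs Ms} → Symmetric G →
    Any (_≗ edge G) bs → Any (_≐ inner G) Ms →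
    (∀ {b M} → b ≗ edge G → M ≐ inner G → corner G ∈ corners b M) →
    Any (_≐ G) (bordered corners bs Ms)
  bordered-complete G-sym b∈ M∈ corner∈ = concatMap⁺ _ (Any.map
    (λ (b≗ , M≐) → map⁺ (Any.map (λ g≡ → border-≐ G-sym g≡ b≗ M≐) (corner∈ b≗ M≐)))
    (cartesianProductWith⁺ _,_ _,_ b∈ M∈))

  symmetricMatrices : ∀ k → List (Matrix k)
  symmetricMatrices zero    = [ (λ ()) ]
  symmetricMatrices (suc k) = bordered (λ _ _ → elements) (vectors k) (symmetricMatrices k)

  symmetricMatrices-complete : ∀ k (G : Matrix k) → Symmetric G → Any (_≐ G) (symmetricMatrices k)
  symmetricMatrices-complete zero    G G-sym = here (λ ())
  symmetricMatrices-complete (suc k) G G-sym = bordered-complete G-sym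
    (vectors-complete k (edge G))
    (symmetricMatrices-complete k (inner G) (inner-symmetric G-sym))
    (λ _ _ → ∈-elements (corner G))

  length-symmetricMatrices : ∀ k → length (symmetricMatrices k) ≤ size ^ triangle k
  length-symmetricMatrices zero    = ℕ.≤-refl
  length-symmetricMatrices (suc k) = begin
    length (symmetricMatrices (suc k))                     ≤⟨ length-bordered (λ _ _ → ℕ.≤-reflexive length-elements) (vectors k) (symmetricMatrices k) ⟩
    length (vectors k) * length (symmetricMatrices k) * size ≤⟨ ℕ.*-monoˡ-≤ size (ℕ.*-mono-≤ (ℕ.≤-reflexive (length-vectors k)) (length-symmetricMatrices k)) ⟩
    size ^ k * size ^ triangle k * size                    ≡⟨ ℕ.*-comm _ size ⟩
    size * (size ^ k * size ^ triangle k)                  ≡⟨ cong (size *_) (ℕ.^-distribˡ-+-* size k (triangle k)) ⟨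
    size ^ triangle (suc k)                                ∎
    where open ℕ.≤-Reasoning

  schurCorners : ∀ {k} → Vector Carrier k → Matrix k → List Carrier
  schurCorners {k} b M with any? (balances? b M) (vectors k)
  ... | yes found = [ ⊖ (proj₁ (satisfied found) ∙ b) ]
  ... | no  _     = []

  length-schurCorners : ∀ {k} (b : Vector Carrier k) M → length (schurCorners b M) ≤ 1
  length-schurCorners {k} b M with any? (balances? b M) (vectors k)
  ... | yes _ = ℕ.≤-refl
  ... | no  _ = z≤n

  schurCorners-complete : ∀ {k} {b : Vector Carrier k} {M e g} → Symmetric M →
    Balances b M e → g ⊕ e ∙ b ≡ 𝟘 → g ∈ schurCorners b M
  schurCorners-complete {k} {b} {M} {e} {g} M-sym bal g⊕e∙b≡𝟘 with any? (balances? b M) (vectors k)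
  ... | yes found = here (trans (inverseˡ-unique g (e ∙ b) g⊕e∙b≡𝟘)
                                (cong ⊖_ (Balances-dot-unique M-sym bal (proj₂ (satisfied found)))))
  ... | no  none  = ⊥-elim (none (Any.map (λ e'≗e → Balances-resp (λ _ → refl) (λ _ _ → refl) (sym ∘ e'≗e) bal)
                                          (vectors-complete k e)))

  singularCover : ∀ k → List (Matrix k)
  singularCover zero    = []
  singularCover (suc k) = bordered (λ _ _ → elements) (vectors k) (singularCover k)
                       ++ bordered schurCorners (vectors k) (symmetricMatrices k)

  singularCover-complete : ∀ k (G : Matrix k) → Symmetric G → ∀ c → ¬ (∀ i → c i ≡ 𝟘) →
    InKernel G c → Any (_≐ G) (singularCover k)
  singularCover-complete zero    G G-sym c c≢𝟘 ker = ⊥-elim (c≢𝟘 (λ ()))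
  singularCover-complete (suc k) G G-sym c c≢𝟘 ker with c zero ≟ 𝟘
  ... | yes c₀≡𝟘 = ++⁺ˡ (bordered-complete G-sym (vectors-complete k (edge G))
          (singularCover-complete k (inner G) (inner-symmetric G-sym) (tail c) c'≢𝟘 (InKernel-inner {G = G} {c} c₀≡𝟘 ker))
          (λ _ _ → ∈-elements (corner G)))
    where
    c'≢𝟘 : ¬ (∀ i → c (suc i) ≡ 𝟘)
    c'≢𝟘 c'≡𝟘 = c≢𝟘 (λ { zero → c₀≡𝟘 ; (suc i) → c'≡𝟘 i })
  ... | no  c₀≢𝟘 = ++⁺ʳ _ (via-unitPivot (InKernel-unitPivot {c = c} G-sym c₀≢𝟘 ker))
    where
    via-unitPivot : ∃[ e ] (Balances (edge G) (inner G) e × corner G ⊕ e ∙ edge G ≡ 𝟘) →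
      Any (_≐ G) (bordered schurCorners (vectors k) (symmetricMatrices k))
    via-unitPivot (e , balanced , corner-balanced) = bordered-complete G-sym (vectors-complete k (edge G))
      (symmetricMatrices-complete k (inner G) (inner-symmetric G-sym))
      (λ b≗ M≐ → schurCorners-complete (λ i j → trans (M≐ i j) (trans (G-sym _ _) (sym (M≐ j i))))
                    (Balances-resp (sym ∘ b≗) (λ i j → sym (M≐ i j)) (λ _ → refl) balanced)
                    (trans (cong (corner G ⊕_) (∑-cong k (λ i → cong (e i ·_) (b≗ i)))) corner-balanced))

  length-singularCover : ∀ k → length (singularCover k) ≤ k * size ^ (triangle k ∸ 1)
  length-singularCover zero    = z≤n
  length-singularCover (suc k) = begin
    length (singularCover (suc k))
      ≡⟨ length-++ (bordered (λ _ _ → elements) (vectors k) (singularCover k)) ⟩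
    length (bordered (λ _ _ → elements) (vectors k) (singularCover k))
      + length (bordered schurCorners (vectors k) (symmetricMatrices k))
      ≤⟨ ℕ.+-mono-≤ (length-bordered (λ _ _ → ℕ.≤-reflexive length-elements) (vectors k) (singularCover k))
                    (length-bordered length-schurCorners (vectors k) (symmetricMatrices k)) ⟩
    length (vectors k) * length (singularCover k) * size
      + length (vectors k) * length (symmetricMatrices k) * 1
      ≤⟨ ℕ.+-mono-≤ (ℕ.*-monoˡ-≤ size (ℕ.*-mono-≤ (ℕ.≤-reflexive (length-vectors k)) (length-singularCover k)))
                    (ℕ.*-monoˡ-≤ 1 (ℕ.*-mono-≤ (ℕ.≤-reflexive (length-vectors k)) (length-symmetricMatrices k))) ⟩
    size ^ k * (k * size ^ (triangle k ∸ 1)) * size + size ^ k * size ^ triangle k * 1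
      ≡⟨ cong (λ t → t + size ^ k * size ^ triangle k * 1) (ℕ.*-assoc (size ^ k) _ size) ⟩
    size ^ k * (k * size ^ (triangle k ∸ 1) * size) + size ^ k * size ^ triangle k * 1
      ≡⟨ cong (λ t → size ^ k * t + size ^ k * size ^ triangle k * 1) (restore-exponent k) ⟩
    size ^ k * (k * size ^ triangle k) + size ^ k * size ^ triangle k * 1
      ≡⟨ collect (size ^ k) k (size ^ triangle k) ⟩
    suc k * (size ^ k * size ^ triangle k)
      ≡⟨ cong (suc k *_) (ℕ.^-distribˡ-+-* size k (triangle k)) ⟨
    suc k * size ^ (triangle (suc k) ∸ 1)
      ∎
    where
    open ℕ.≤-Reasoning
    restore-exponent : ∀ k → k * size ^ (triangle k ∸ 1) * size ≡ k * size ^ triangle k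
    restore-exponent zero    = refl
    restore-exponent (suc k) = trans (ℕ.*-assoc (suc k) (size ^ (k + triangle k)) size) (cong (suc k *_) (ℕ.*-comm _ size))
    collect : ∀ p k t → p * (k * t) + p * t * 1 ≡ suc k * (p * t)
    collect = solve-∀

  module QuadraticForm {d} (A : QuadForm F d) where

    Q : Vector Carrier d → Carrier
    Q = evalQ F A

    ∑² : (Fin d → Fin d → Carrier) → Carrier
    ∑² f = ∑ F d (λ i → ∑ F d (f i))

    ∑²-cong : ∀ {f g} → (∀ i j → f i j ≡ g i j) → ∑² f ≡ ∑² g
    ∑²-cong f≐g = ∑-cong d (λ i → ∑-cong d (f≐g i))

    ∑²-distrib-⊕ : ∀ f g → ∑² (λ i j → f i j ⊕ g i j) ≡ ∑² f ⊕ ∑² g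
    ∑²-distrib-⊕ f g = trans (∑-cong d (λ i → ∑-distrib-⊕ d (f i) (g i))) (∑-distrib-⊕ d _ _)

    *-distribˡ-∑² : ∀ a f → a · ∑² f ≡ ∑² (λ i j → a · f i j)
    *-distribˡ-∑² a f = trans (*-distribˡ-∑ d a _) (∑-cong d (λ i → *-distribˡ-∑ d a (f i)))

    ∑²-zero : ∀ {f} → (∀ i j → f i j ≡ 𝟘) → ∑² f ≡ 𝟘
    ∑²-zero f≡𝟘 = ∑-zero d (λ i → ∑-zero d (f≡𝟘 i))

    B : Vector Carrier d → Vector Carrier d → Carrier
    B x y = ∑² (λ i j → A i j · x i · y j ⊕ A i j · y i · x j)

    Q-cong : ∀ {x y} → x ≗ y → Q x ≡ Q y
    Q-cong x≗y = ∑²-cong (λ i j → cong₂ (λ u v → A i j · u · v) (x≗y i) (x≗y j))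

    B-congˡ : ∀ {x x'} y → x ≗ x' → B x y ≡ B x' y
    B-congˡ y x≗x' = ∑²-cong (λ i j → cong₂ (λ u v → A i j · u · y j ⊕ A i j · y i · v) (x≗x' i) (x≗x' j))

    B-sym : ∀ x y → B x y ≡ B y x
    B-sym x y = ∑²-cong (λ i j → CommutativeRing.+-comm commutativeRing _ _)

    B-diag : ∀ x → B x x ≡ Q x ⊕ Q x
    B-diag x = ∑²-distrib-⊕ _ _

    B-zeroˡ : ∀ y → B (λ _ → 𝟘) y ≡ 𝟘
    B-zeroˡ y = ∑²-zero (λ i j → zero-terms (A i j) (y i) (y j))
      where
      zero-terms : ∀ a u v → a · 𝟘 · v ⊕ a · u · 𝟘 ≡ 𝟘
      zero-terms a u v = trans (cong₂ _⊕_ (trans (cong (_· v) (zeroʳ a)) (zeroˡ v)) (zeroʳ (a · u))) (+-identityʳ 𝟘)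

    Q-zero : Q (λ _ → 𝟘) ≡ 𝟘
    Q-zero = ∑²-zero (λ i j → trans (cong (_· 𝟘) (zeroʳ (A i j))) (zeroʳ 𝟘))

    B-affineˡ : ∀ a u w y → B (λ m → a · u m ⊕ w m) y ≡ a · B u y ⊕ B w y
    B-affineˡ a u w y = begin
      B (λ m → a · u m ⊕ w m) y
        ≡⟨ ∑²-cong (λ i j → expand (A i j) a (u i) (w i) (u j) (w j) (y i) (y j)) ⟩
      ∑² (λ i j → a · (A i j · u i · y j ⊕ A i j · y i · u j) ⊕ (A i j · w i · y j ⊕ A i j · y i · w j))
        ≡⟨ ∑²-distrib-⊕ _ _ ⟩
      ∑² (λ i j → a · (A i j · u i · y j ⊕ A i j · y i · u j)) ⊕ B w y
        ≡⟨ cong (_⊕ B w y) (*-distribˡ-∑² a _) ⟨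
      a · B u y ⊕ B w y
        ∎
      where
      open ≡-Reasoning
      expand : ∀ c a ui wi uj wj yi yj →
        c · (a · ui ⊕ wi) · yj ⊕ c · yi · (a · uj ⊕ wj) ≡ a · (c · ui · yj ⊕ c · yi · uj) ⊕ (c · wi · yj ⊕ c · yi · wj)
      expand = solve 8 (λ c a ui wi uj wj yi yj →
        c :* (a :* ui :+ wi) :* yj :+ c :* yi :* (a :* uj :+ wj) := a :* (c :* ui :* yj :+ c :* yi :* uj) :+ (c :* wi :* yj :+ c :* yi :* wj)) refl

    B-linearˡ : ∀ k (c : Vector Carrier k) (v : Fin k → Vector Carrier d) y →
      B (λ m → ∑ F k (λ i → c i · v i m)) y ≡ ∑ F k (λ i → c i · B (v i) y)
    B-linearˡ zero    c v y = B-zeroˡ y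
    B-linearˡ (suc k) c v y = trans (B-affineˡ (c zero) (v zero) _ y)
                                    (cong (c zero · B (v zero) y ⊕_) (B-linearˡ k (tail c) (v ∘ suc) y))

    -- z plays the role of x − y.
    law-of-cosines : ∀ {x y z} → (∀ m → z m ⊕ y m ≡ x m) → Q z ⊕ B x y ≡ Q x ⊕ Q y
    law-of-cosines {x} {y} {z} z⊕y≗x = begin
      Q z ⊕ B x y
        ≡⟨ cong (Q z ⊕_) (B-congˡ y (sym ∘ z⊕y≗x)) ⟩
      Q z ⊕ B x' y
        ≡⟨ ∑²-distrib-⊕ _ _ ⟨
      ∑² (λ i j → A i j · z i · z j ⊕ (A i j · x' i · y j ⊕ A i j · y i · x' j))
        ≡⟨ ∑²-cong (λ i j → expand (A i j) (z i) (y i) (z j) (y j)) ⟩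
      ∑² (λ i j → A i j · x' i · x' j ⊕ A i j · y i · y j)
        ≡⟨ ∑²-distrib-⊕ _ _ ⟩
      Q x' ⊕ Q y
        ≡⟨ cong (_⊕ Q y) (Q-cong z⊕y≗x) ⟩
      Q x ⊕ Q y
        ∎
      where
      open ≡-Reasoning
      x' : Vector Carrier d
      x' m = z m ⊕ y m
      expand : ∀ a zi yi zj yj →
        a · zi · zj ⊕ (a · (zi ⊕ yi) · yj ⊕ a · yi · (zj ⊕ yj)) ≡ a · (zi ⊕ yi) · (zj ⊕ yj) ⊕ a · yi · yj
      expand = solve 5 (λ a zi yi zj yj →
        a :* zi :* zj :+ (a :* (zi :+ yi) :* yj :+ a :* yi :* (zj :+ yj)) := a :* (zi :+ yi) :* (zj :+ yj) :+ a :* yi :* yj) refl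

    Q-opposite : ∀ {y z} → (∀ m → z m ⊕ y m ≡ 𝟘) → Q z ≡ Q y
    Q-opposite {y} {z} z⊕y≡𝟘 = begin
      Q z                      ≡⟨ +-identityʳ (Q z) ⟨
      Q z ⊕ 𝟘                  ≡⟨ cong (Q z ⊕_) (B-zeroˡ y) ⟨
      Q z ⊕ B (λ _ → 𝟘) y      ≡⟨ law-of-cosines z⊕y≡𝟘 ⟩
      Q (λ _ → 𝟘) ⊕ Q y        ≡⟨ cong (_⊕ Q y) Q-zero ⟩
      𝟘 ⊕ Q y                  ≡⟨ +-identityˡ (Q y) ⟩
      Q y                      ∎
      where open ≡-Reasoning

    module _ {k} (x : Simplex F d k) where

      edgeVector : Fin k → Vector Carrier d
      edgeVector i = _-ᵥ_ F (x (suc i)) (x zero)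

      gram : Matrix k
      gram i j = B (edgeVector i) (edgeVector j)

      gram-symmetric : Symmetric gram
      gram-symmetric i j = B-sym (edgeVector i) (edgeVector j)

      gram-kernel : ∀ {c} → (∀ m → ∑ F k (λ i → c i · edgeVector i m) ≡ 𝟘) → InKernel gram c
      gram-kernel {c} dependent j = begin
        ∑ F k (λ i → c i · gram i j)                                  ≡⟨ B-linearˡ k c edgeVector (edgeVector j) ⟨
        B (λ m → ∑ F k (λ i → c i · edgeVector i m)) (edgeVector j)   ≡⟨ B-congˡ (edgeVector j) dependent ⟩
        B (λ _ → 𝟘) (edgeVector j)                                    ≡⟨ B-zeroˡ (edgeVector j) ⟩
        𝟘                                                             ∎
        where open ≡-Reasoning

    -- h is meant to be the inverse of 𝟙 ⊕ 𝟙; the entries with i ≥ j are never inspected.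
    distancesOf : ∀ {k} → Carrier → Matrix k → DistVec F k
    distancesOf h G zero    (suc j) = h · G j j
    distancesOf h G (suc i) (suc j) = (h · G i i ⊕ h · G j j) ⊕ ⊖ G i j
    distancesOf h G _       zero    = 𝟘

    distancesOf-correct : ∀ {k} (x : Simplex F d k) {h G} → (𝟙 ⊕ 𝟙) · h ≡ 𝟙 → G ≐ gram x →
      IsDistVecOf F A (distancesOf h G) x
    distancesOf-correct x {h} {G} 2h≡𝟙 G≐gram = distances
      where
      open ≡-Reasoning
      v = edgeVector x

      chain : ∀ a b c → (a ⊕ ⊖ b) ⊕ (b ⊕ ⊖ c) ≡ a ⊕ ⊖ c
      chain a b c = trans (sym (+-assoc (a ⊕ ⊖ b) b (⊖ c))) (cong (_⊕ ⊖ c) (//-rightDividesˡ b a))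

      halve : ∀ i → h · G i i ≡ Q (v i)
      halve i = begin
        h · G i i                  ≡⟨ cong (h ·_) (trans (G≐gram i i) (B-diag (v i))) ⟩
        h · (Q (v i) ⊕ Q (v i))    ≡⟨ cong (λ t → h · (t ⊕ t)) (*-identityˡ (Q (v i))) ⟨
        h · (𝟙 · Q (v i) ⊕ 𝟙 · Q (v i)) ≡⟨ regroup h 𝟙 (Q (v i)) ⟩
        ((𝟙 ⊕ 𝟙) · h) · Q (v i)    ≡⟨ cong (_· Q (v i)) 2h≡𝟙 ⟩
        𝟙 · Q (v i)                ≡⟨ *-identityˡ (Q (v i)) ⟩
        Q (v i)                    ∎
        where
        regroup : ∀ h o a → h · (o · a ⊕ o · a) ≡ ((o ⊕ o) · h) · a
        regroup = solve 3 (λ h o a → h :* (o :* a :+ o :* a) := ((o :+ o) :* h) :* a) refl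

      distances : IsDistVecOf F A (distancesOf h G) x
      distances zero    zero    ()
      distances (suc i) zero    ()
      distances zero    (suc j) _ = begin
        h · G j j                  ≡⟨ halve j ⟩
        Q (v j)                    ≡⟨ Q-opposite (λ m → trans (chain _ _ _) (-‿inverseʳ (x zero m))) ⟨
        Q (_-ᵥ_ F (x zero) (x (suc j))) ∎
      distances (suc i) (suc j) _ = begin
        (h · G i i ⊕ h · G j j) ⊕ ⊖ G i j                ≡⟨ cong₂ (λ s t → s ⊕ ⊖ t) (cong₂ _⊕_ (halve i) (halve j)) (G≐gram i j) ⟩
        (Q (v i) ⊕ Q (v j)) ⊕ ⊖ B (v i) (v j)            ≡⟨ cong (_⊕ ⊖ B (v i) (v j)) (law-of-cosines (λ m → chain _ _ _)) ⟨
        (Q z ⊕ B (v i) (v j)) ⊕ ⊖ B (v i) (v j)          ≡⟨ //-rightDividesʳ (B (v i) (v j)) (Q z) ⟩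
        Q z                                              ∎
        where
        z = _-ᵥ_ F (x (suc i)) (x (suc j))

    degenerateDistances-count : ∀ k h → (𝟙 ⊕ 𝟙) · h ≡ 𝟙 →
      DegDistCountAtMost F d k A (k * size ^ (triangle k ∸ 1))
    degenerateDistances-count k h 2h≡𝟙 =
      map (distancesOf h) (singularCover k) ,
      ℕ.≤-trans (ℕ.≤-reflexive (length-map (distancesOf h) (singularCover k))) (length-singularCover k) ,
      λ x (c , c≢𝟘 , dependent) → map⁺ (Any.map (distancesOf-correct x 2h≡𝟙)
        (singularCover-complete k (gram x) (gram-symmetric x) c c≢𝟘 (gram-kernel x dependent)))

lemma7p4 : ∀ (d k : ℕ) → k ≤ d →
    ∃[ C ] ∃[ q₀ ] (∀ (F : FiniteField) → ¬ (2 ∣ FiniteField.size F) → q₀ ≤ FiniteField.size F →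
      ∀ (A : QuadForm F d) → NonDegenerate F A →
        DegDistCountAtMost F d k A (C * k * FiniteField.size F ^ ((k * suc k) / 2 ∸ 1)))
lemma7p4 d k _ = 1 , 0 , λ F odd _ A _ →
  let (h , 2h≡𝟙) = FiniteField.inverse F _ (𝟙⊕𝟙≢𝟘 F odd)
  in subst (DegDistCountAtMost F d k A)
           (cong₂ (λ c t → c * FiniteField.size F ^ (t ∸ 1)) (sym (ℕ.*-identityˡ k)) (triangle≡k*[1+k]/2 k))
           (QuadraticForm.degenerateDistances-count F A k h 2h≡𝟙)
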